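{- Let $G$ be a connected graph and $X$ a nonempty subset of $V(G)$ such that every proper subset $X'\subsetneq X$ is a total mutual-visibility set of $G$. Then $X$ is not a total mutual-visibility set of $G$ if and only if there exist two nonadjacent vertices $v_1,v_2$ of $G$ with $N_G(v_1)\cap N_G(v_2)=X$.
   Context: For $X\subseteq V(G)$, two vertices $x,y$ are $X$-visible if there is a shortest $x,y$-path in $G$ with no internal vertex in $X$; $X$ is a total mutual-visibility set if any two vertices of $V(G)$ are $X$-visible. $N_G(v)$ denotes the set of neighbours of $v$. -}

module Defs where

open import Data.Nat using (ℕ; zero; suc; _≤_)
open import Data.Bool using (Bool; true; false)
open import Data.Fin using (Fin)
open import Data.Fin.Subset using (Subset; _∈_; _∉_)
open import Data.List using (List; []; _∷_)
open import Data.List.Relation.Unary.All using (All)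
open import Data.Vec using (tabulate)
open import Data.Product using (Σ; _×_; ∃)
open import Relation.Binary.PropositionalEquality using (_≡_)

record Graph (n : ℕ) : Set where
  field
    adj       : Fin n → Fin n → Bool
    adj-sym   : ∀ u v → adj u v ≡ adj v u
    adj-irref : ∀ v → adj v v ≡ false

module _ {n : ℕ} (G : Graph n) where
  open Graph G

  data Walk : Fin n → Fin n → Set where
    nil  : ∀ {x} → Walk x x
    cons : ∀ {x z y} → adj x z ≡ true → Walk z y → Walk x y

  len : ∀ {x y} → Walk x y → ℕ
  len nil        = zero
  len (cons _ p) = suc (len p)

  -- the vertices of a walk from z, including z but excluding the final vertex
  private
    innerFrom : ∀ {z y} → Walk z y → List (Fin n)
    innerFrom nil                 = []
    innerFrom {z} (cons _ p)      = z ∷ innerFrom p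

  internal : ∀ {x y} → Walk x y → List (Fin n)
  internal nil        = []
  internal (cons _ p) = innerFrom p

  Shortest : ∀ {x y} → Walk x y → Set
  Shortest {x} {y} P = ∀ (Q : Walk x y) → len P ≤ len Q

  Connected : Set
  Connected = ∀ x y → Walk x y

  Visible : Subset n → Fin n → Fin n → Set
  Visible X x y = Σ (Walk x y) λ P → Shortest P × All (λ v → v ∉ X) (internal P)

  TotalMutualVisibility : Subset n → Set
  TotalMutualVisibility X = ∀ x y → Visible X x y

  N : Fin n → Subset n
  N v = tabulate (adj v)

-- A pair x, y that is not X-visible at distance d ≥ 3 yields such a pair at
-- distance 2 or d - 1.  Let x - a - b begin a geodesic from x to y.  Either x, b
-- are not X-visible, or some x - c - b has c ∉ X; then c, y are at distance
-- d - 1 and are not X-visible, since prefixing x would make x, y X-visible.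
-- For a pair u, v that is not X-visible at distance 2, every common neighbour
-- lies in X (otherwise it gives an X-free geodesic), and every i ∈ X is a common
-- neighbour, because a geodesic from u to v avoiding X - i must pass through i.
-- Conversely, if N(v₁) ∩ N(v₂) = X ≠ ∅ for nonadjacent v₁ ≠ v₂, every geodesic
-- from v₁ to v₂ has length 2 and its middle vertex lies in X.
module Submission where

open import Defs
open import Data.Nat using (ℕ; zero; suc; _+_; _≤_; s≤s)
open import Data.Nat.Properties using (≤-antisym; +-cancelˡ-≤; +-cancelʳ-≤; suc-injective)
open import Data.Bool using (true; false)
open import Data.Bool.Properties using () renaming (_≟_ to _≟ᴮ_)
open import Data.Fin using (Fin; _≟_)
open import Data.Fin.Subset using (Subset; _⊂_; _⊆_; _∩_; Nonempty; _∈_; _∉_; _-_)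
open import Data.Fin.Subset.Properties
  using (_∈?_; x∈p∩q⁺; x∈p∩q⁻; ⊆-antisym; x∈p∧x≢y⇒x∈p-y; x∈p⇒p-x⊂p)
open import Data.Fin.Properties using (any?; all?; ¬∀⟶∃¬)
open import Data.Vec.Properties using (lookup∘tabulate; []=⇒lookup; lookup⇒[]=)
open import Data.List.Relation.Unary.All using (All; []; _∷_)
open import Data.Product using (∃; ∃₂; _×_; _,_; Σ)
open import Relation.Nullary using (¬_; Dec; yes; no; ¬?; contradiction)
open import Relation.Nullary.Decidable using (_×-dec_)
open import Relation.Binary.PropositionalEquality
  using (_≡_; _≢_; refl; sym; trans; cong; subst; subst₂)
open import Function.Bundles using (_⇔_; mk⇔)

x∉p-y∧x≢y⇒x∉p : ∀ {n} {X : Subset n} {i z} → i ∉ X - z → i ≢ z → i ∉ X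
x∉p-y∧x≢y⇒x∉p i∉X-z i≢z i∈X = i∉X-z (x∈p∧x≢y⇒x∈p-y i∈X i≢z)

¬∀∀⇒∃∃¬ : ∀ {n} {R : Fin n → Fin n → Set} → (∀ x y → Dec (R x y)) →
  ¬ (∀ x y → R x y) → ∃₂ λ x y → ¬ R x y
¬∀∀⇒∃∃¬ {n} {R} R? ¬∀∀ with ¬∀⟶∃¬ n (λ x → ∀ y → R x y) (λ x → all? (R? x)) ¬∀∀
... | x , ¬∀R with ¬∀⟶∃¬ n (R x) (R? x) ¬∀R
... | y , ¬R = x , y , ¬R

module _ {n : ℕ} (G : Graph n) where
  open Graph G

  adj⇒∈N : ∀ {v i} → adj v i ≡ true → i ∈ N G v
  adj⇒∈N {v} {i} e = lookup⇒[]= i _ (trans (lookup∘tabulate (adj v) i) e)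

  ∈N⇒adj : ∀ {v i} → i ∈ N G v → adj v i ≡ true
  ∈N⇒adj {v} {i} i∈Nv = trans (sym (lookup∘tabulate (adj v) i)) ([]=⇒lookup i∈Nv)

  ∈N∩N⇒adj : ∀ {x i y} → i ∈ N G x ∩ N G y → adj x i ≡ true × adj i y ≡ true
  ∈N∩N⇒adj {x} {i} {y} i∈N∩N with x∈p∩q⁻ (N G x) (N G y) i∈N∩N
  ... | i∈Nx , i∈Ny = ∈N⇒adj i∈Nx , trans (adj-sym i y) (∈N⇒adj i∈Ny)

  adj⇒∈N∩N : ∀ {x i y} → adj x i ≡ true → adj i y ≡ true → i ∈ N G x ∩ N G y
  adj⇒∈N∩N {i = i} {y} e e' = x∈p∩q⁺ (adj⇒∈N e , adj⇒∈N (trans (adj-sym y i) e'))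

  _++_ : ∀ {x y z} → Walk G x y → Walk G y z → Walk G x z
  nil      ++ Q = Q
  cons e P ++ Q = cons e (P ++ Q)

  len-++ : ∀ {x y z} (P : Walk G x y) (Q : Walk G y z) → len G (P ++ Q) ≡ len G P + len G Q
  len-++ nil        Q = refl
  len-++ (cons e P) Q = cong suc (len-++ P Q)

  Shortest⇒len≡ : ∀ {x y} (P Q : Walk G x y) → Shortest G P → Shortest G Q → len G P ≡ len G Q
  Shortest⇒len≡ P Q sP sQ = ≤-antisym (sP Q) (sQ P)

  Shortest-resp-len : ∀ {x y} (P Q : Walk G x y) → Shortest G P → len G Q ≡ len G P → Shortest G Q
  Shortest-resp-len _ _ sP Q≡P R = subst (_≤ _) (sym Q≡P) (sP R)

  Shortest-++ˡ : ∀ {x y z} (P : Walk G x y) (Q : Walk G y z) → Shortest G (P ++ Q) → Shortest G P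
  Shortest-++ˡ P Q sPQ P' =
    +-cancelʳ-≤ (len G Q) _ _ (subst₂ _≤_ (len-++ P Q) (len-++ P' Q) (sPQ (P' ++ Q)))

  Shortest-++ʳ : ∀ {x y z} (P : Walk G x y) (Q : Walk G y z) → Shortest G (P ++ Q) → Shortest G Q
  Shortest-++ʳ P Q sPQ Q' =
    +-cancelˡ-≤ (len G P) _ _ (subst₂ _≤_ (len-++ P Q) (len-++ P Q') (sPQ (P ++ Q')))

  Shortest-tail : ∀ {x a y} (e : adj x a ≡ true) (R : Walk G a y) → Shortest G (cons e R) → Shortest G R
  Shortest-tail e = Shortest-++ʳ (cons e nil)

  Geodesic : ℕ → Fin n → Fin n → Set
  Geodesic k x y = Σ (Walk G x y) λ P → Shortest G P × len G P ≡ k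

  Geodesic⇒≢ : ∀ {k x y} → Geodesic (suc k) x y → x ≢ y
  Geodesic⇒≢ (P , sP , P≡1+k) refl with subst (_≤ 0) P≡1+k (sP nil)
  ... | ()

  Geodesic⇒nonadjacent : ∀ {k x y} → Geodesic (suc (suc k)) x y → adj x y ≡ false
  Geodesic⇒nonadjacent {x = x} {y} (P , sP , P≡2+k) with adj x y in e
  ... | false = refl
  ... | true with subst (_≤ 1) P≡2+k (sP (cons e nil))
  ...   | s≤s ()

  Geodesic⇒Shortest : ∀ {k x y} → Geodesic k x y → (Q : Walk G x y) → len G Q ≡ k → Shortest G Q
  Geodesic⇒Shortest (P , sP , P≡k) Q Q≡k = Shortest-resp-len P Q sP (trans Q≡k (sym P≡k))

  Geodesic⇒len≡ : ∀ {k x y} → Geodesic k x y → (Q : Walk G x y) → Shortest G Q → len G Q ≡ k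
  Geodesic⇒len≡ (P , sP , P≡k) Q sQ = trans (Shortest⇒len≡ Q P sQ sP) P≡k

  Avoids : ∀ {x y} → Subset n → Walk G x y → Set
  Avoids X P = All (_∉ X) (internal G P)

  Avoids-cons : ∀ {X x a y} (e : adj x a ≡ true) {Q : Walk G a y} →
    a ∉ X → Avoids X Q → Avoids X (cons e Q)
  Avoids-cons e {nil}      a∉X _   = []
  Avoids-cons e {cons _ _} a∉X avQ = a∉X ∷ avQ

  avoiding-walk₂-middle : ∀ {X x y} (Q : Walk G x y) → len G Q ≡ 2 → Avoids X Q →
    ∃ λ c → adj x c ≡ true × adj c y ≡ true × c ∉ X
  avoiding-walk₂-middle (cons e (cons e' nil)) _ (c∉X ∷ []) = _ , e , e' , c∉X

  AvoidingWalk : Subset n → ℕ → Fin n → Fin n → Set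
  AvoidingWalk X k x y = Σ (Walk G x y) λ Q → len G Q ≡ k × Avoids X Q

  avoidingWalk? : ∀ X k x y → Dec (AvoidingWalk X k x y)
  avoidingWalk? X zero x y with x ≟ y
  ... | yes refl = yes (nil , refl , [])
  ... | no x≢y   = no λ { (nil , _ , _) → x≢y refl ; (cons _ _ , () , _) }
  avoidingWalk? X (suc zero) x y with adj x y ≟ᴮ true
  ... | yes e  = yes (cons e nil , refl , [])
  ... | no ¬e  = no λ { (cons e nil , _ , _) → ¬e e
                      ; (nil , () , _) ; (cons _ (cons _ _) , () , _) }
  avoidingWalk? X (suc (suc k)) x y
    with any? (λ c → (adj x c ≟ᴮ true) ×-dec (¬? (c ∈? X) ×-dec avoidingWalk? X (suc k) c y))
  ... | yes (c , e , c∉X , Q , Q≡k , avQ) = yes (cons e Q , cong suc Q≡k , Avoids-cons e c∉X avQ)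
  ... | no ¬∃ = no λ
    { (cons e (cons e' Q) , Q≡k , c∉X ∷ avQ) →
        ¬∃ (_ , e , c∉X , cons e' Q , suc-injective Q≡k , avQ)
    ; (nil , () , _) ; (cons _ nil , () , _) }

  visible? : ∀ X {x y} (P : Walk G x y) → Shortest G P → Dec (Visible G X x y)
  visible? X P sP with avoidingWalk? X (len G P) _ _
  ... | yes (Q , Q≡P , avQ) = yes (Q , Shortest-resp-len P Q sP Q≡P , avQ)
  ... | no ¬Q = no λ (Q , sQ , avQ) → ¬Q (Q , Shortest⇒len≡ Q P sQ sP , avQ)

  cons-visible : ∀ {X x a y} (e : adj x a ≡ true) (R : Walk G a y) →
    a ∉ X → Shortest G (cons e R) → Visible G X a y → Visible G X x y
  cons-visible e R a∉X sP (Q , sQ , avQ) =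
    cons e Q ,
    Shortest-resp-len (cons e R) (cons e Q) sP
      (cong suc (Shortest⇒len≡ Q R sQ (Shortest-tail e R sP))) ,
    Avoids-cons e a∉X avQ

  geodesic₂-visible-via : ∀ {X x c y} → Geodesic 2 x y →
    adj x c ≡ true → adj c y ≡ true → c ∉ X → Visible G X x y
  geodesic₂-visible-via g e e' c∉X =
    cons e (cons e' nil) , Geodesic⇒Shortest g (cons e (cons e' nil)) refl , c∉X ∷ []

  invisible-geodesic₂⇒N∩N⊆ : ∀ {X x y} → Geodesic 2 x y → ¬ Visible G X x y → N G x ∩ N G y ⊆ X
  invisible-geodesic₂⇒N∩N⊆ {X} g ¬vis {i} i∈N∩N with i ∈? X | ∈N∩N⇒adj i∈N∩N
  ... | yes i∈X | _       = i∈X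
  ... | no i∉X  | e , e' = contradiction (geodesic₂-visible-via g e e' i∉X) ¬vis

  invisible-geodesic₂⇒⊆N∩N : ∀ {X x y} → Geodesic 2 x y → ¬ Visible G X x y →
    (∀ {i} → i ∈ X → Visible G (X - i) x y) → X ⊆ N G x ∩ N G y
  invisible-geodesic₂⇒⊆N∩N g ¬vis vis-X-i {i} i∈X with vis-X-i i∈X
  ... | Q , sQ , avQ with avoiding-walk₂-middle Q (Geodesic⇒len≡ g Q sQ) avQ
  ... | c , e , e' , c∉X-i with c ≟ i
  ...   | yes refl = adj⇒∈N∩N e e'
  ...   | no c≢i  = contradiction (geodesic₂-visible-via g e e' (x∉p-y∧x≢y⇒x∉p c∉X-i c≢i)) ¬vis

  common-neighbours⊆⇒invisible : ∀ {X x y} → x ≢ y → adj x y ≡ false →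
    Nonempty (N G x ∩ N G y) → N G x ∩ N G y ⊆ X → ¬ Visible G X x y
  common-neighbours⊆⇒invisible x≢y _ _ _ (nil , _ , _) = x≢y refl
  common-neighbours⊆⇒invisible _ nonadj _ _ (cons e nil , _ , _) with trans (sym e) nonadj
  ... | ()
  common-neighbours⊆⇒invisible _ _ _ N∩N⊆X (cons e (cons e' nil) , _ , c∉X ∷ []) =
    c∉X (N∩N⊆X (adj⇒∈N∩N e e'))
  common-neighbours⊆⇒invisible _ _ (i , i∈N∩N) _ (cons _ (cons _ (cons _ _)) , sP , _)
    with ∈N∩N⇒adj i∈N∩N
  ... | e , e' with sP (cons e (cons e' nil))
  ...   | s≤s (s≤s ())

  InvisibleGeodesic₂ : Subset n → Set
  InvisibleGeodesic₂ X = ∃₂ λ u v → Geodesic 2 u v × ¬ Visible G X u v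

  -- The geodesic is split as x - a - b followed by T, so that both recursive
  -- calls are on a subterm of T.
  descend : ∀ {X x a b y} (e : adj x a ≡ true) (e' : adj a b ≡ true) (T : Walk G b y) →
    Shortest G (cons e (cons e' T)) → ¬ Visible G X x y → InvisibleGeodesic₂ X
  descend e e' nil sP ¬vis = _ , _ , (cons e (cons e' nil) , sP , refl) , ¬vis
  descend {X} {x} {b = b} e e' T@(cons e'' R) sP ¬vis = bypass (visible? X S sS)
    where
    S : Walk G x b
    S = cons e (cons e' nil)

    sS : Shortest G S
    sS = Shortest-++ˡ S T sP

    shortest-via : ∀ {c} (s₁ : adj x c ≡ true) (s₂ : adj c b ≡ true) → Shortest G (cons s₁ (cons s₂ T))
    shortest-via s₁ s₂ = Shortest-resp-len (cons e (cons e' T)) (cons s₁ (cons s₂ T)) sP refl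

    detour : ∀ {c} (s₁ : adj x c ≡ true) (s₂ : adj c b ≡ true) → c ∉ X → InvisibleGeodesic₂ X
    detour s₁ s₂ c∉X with visible? X (cons s₂ T) (Shortest-tail s₁ (cons s₂ T) (shortest-via s₁ s₂))
    ... | no ¬visc = descend s₂ e'' R (Shortest-tail s₁ (cons s₂ T) (shortest-via s₁ s₂)) ¬visc
    ... | yes visc = contradiction (cons-visible s₁ (cons s₂ T) c∉X (shortest-via s₁ s₂) visc) ¬vis

    bypass : Dec (Visible G X x b) → InvisibleGeodesic₂ X
    bypass (no ¬visS) = _ , _ , (S , sS , refl) , ¬visS
    bypass (yes (S' , sS' , avS')) with avoiding-walk₂-middle S' (Shortest⇒len≡ S' S sS' sS) avS'
    ... | c , s₁ , s₂ , c∉X = detour s₁ s₂ c∉X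

  invisible⇒invisible-geodesic₂ : ∀ {X x y} (P : Walk G x y) → Shortest G P →
    ¬ Visible G X x y → InvisibleGeodesic₂ X
  invisible⇒invisible-geodesic₂ nil                  sP ¬vis = contradiction (nil , sP , []) ¬vis
  invisible⇒invisible-geodesic₂ (cons e nil)         sP ¬vis = contradiction (cons e nil , sP , []) ¬vis
  invisible⇒invisible-geodesic₂ (cons e (cons e' T)) sP ¬vis = descend e e' T sP ¬vis

proposition5p4 : ∀ {n : ℕ} (G : Graph n) (X : Subset n) →
    Connected G → Nonempty X →
    (∀ (X' : Subset n) → X' ⊂ X → TotalMutualVisibility G X') →
    ((¬ TotalMutualVisibility G X) ⇔
    (∃₂ λ (v₁ v₂ : Fin n) → v₁ ≢ v₂ × Graph.adj G v₁ v₂ ≡ false × N G v₁ ∩ N G v₂ ≡ X))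
proposition5p4 G X _ (z , z∈X) minimal = mk⇔ forward backward
  where
  visible-without : ∀ {i} → i ∈ X → ∀ x y → Visible G (X - i) x y
  visible-without i∈X = minimal _ (x∈p⇒p-x⊂p i∈X)

  X-visible? : ∀ x y → Dec (Visible G X x y)
  X-visible? x y = let (P , sP , _) = visible-without z∈X x y in visible? G X P sP

  forward : ¬ TotalMutualVisibility G X →
    ∃₂ λ v₁ v₂ → v₁ ≢ v₂ × Graph.adj G v₁ v₂ ≡ false × N G v₁ ∩ N G v₂ ≡ X
  forward ¬tmv with ¬∀∀⇒∃∃¬ X-visible? ¬tmv
  ... | x , y , ¬vis with visible-without z∈X x y
  ... | P , sP , _ with invisible⇒invisible-geodesic₂ G P sP ¬vis
  ... | u , v , g , ¬visuv =
    u , v , Geodesic⇒≢ G g , Geodesic⇒nonadjacent G g ,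
    ⊆-antisym (invisible-geodesic₂⇒N∩N⊆ G g ¬visuv)
              (invisible-geodesic₂⇒⊆N∩N G g ¬visuv λ i∈X → visible-without i∈X u v)

  backward : (∃₂ λ v₁ v₂ → v₁ ≢ v₂ × Graph.adj G v₁ v₂ ≡ false × N G v₁ ∩ N G v₂ ≡ X) →
    ¬ TotalMutualVisibility G X
  backward (v₁ , v₂ , v₁≢v₂ , nonadj , N∩N≡X) tmv =
    common-neighbours⊆⇒invisible G v₁≢v₂ nonadj
      (z , subst (z ∈_) (sym N∩N≡X) z∈X) (subst (_ ∈_) N∩N≡X) (tmv v₁ v₂)
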